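{- The momentum amplituhedron dimension is an invariant of refinement-equivalence classes of Grassmannian forests: if $F$ and $F'$ are refinement-equivalent Grassmannian forests, then $\dim_{\mathcal M}(F)=\dim_{\mathcal M}(F')$.
   Context: A Grassmannian graph is a finite planar graph embedded in a closed disk with $n$ boundary vertices $b_1,\dots,b_n$ of degree $1$ on the boundary circle, labelled clockwise; all other vertices (internal vertices) lie in the interior, each is connected by a path to the boundary, and no vertex has degree $2$. Each internal vertex $v$ carries an integer helicity $h(v)$: if $v$ is a boundary leaf (an internal vertex of degree $1$ adjacent to a boundary vertex) then $h(v)\in\{0,1\}$; otherwise $1\le h(v)\le \deg(v)-1$. An internal vertex is white if $h(v)=1$, black if $h(v)=\deg(v)-1$, and generic otherwise. A Grassmannian forest is an acyclic Grassmannian graph; a Grassmannian tree is a connected one. A vertex contraction move replaces two adjacent internal white vertices (resp. two adjacent internal black vertices) $v_1,v_2$ by a single vertex adjacent to all other neighbours of $v_1,v_2$ (so of degree $\deg v_1+\deg v_2-2$), which is white (resp. black). Two Grassmannian forests are refinement-equivalent if one can be obtained from the other by a sequence of contraction moves and their inverses. For an internal vertex $v$ set $m(v)=2\deg(v)-4$ if $v$ is generic and $m(v)=\deg(v)-1$ otherwise. For a Grassmannian tree $T$ with $n$ boundary vertices, $\dim_{\mathcal M}(T)=n-1$ if $n\le 2$, and $\dim_{\mathcal M}(T)=1+\sum_{v\text{ internal}}(m(v)-1)$ otherwise. For a Grassmannian forest $F$, $\dim_{\mathcal M}(F)$ is the sum of $\dim_{\mathcal M}(T)$ over its connected components $T$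 (each regarded as a Grassmannian tree on its own boundary vertices). -}

module Defs where

open import Data.Nat using (ℕ; zero; suc; _+_; _*_; _∸_; _≤_; _<_; _≡ᵇ_; _<ᵇ_; _≤ᵇ_)
open import Data.Integer as ℤ using (ℤ; +_)
open import Data.Fin using (Fin; toℕ) renaming (zero to fz; suc to fs)
open import Data.Sum using (_⊎_; inj₁; inj₂; [_,_]′)
open import Data.Product using (Σ; ∃; ∃-syntax; _×_; _,_)
open import Data.Bool using (Bool; true; false; _∧_; _∨_; not; if_then_else_)
open import Data.List using (List; []; _∷_; length)
open import Data.List.Membership.Propositional using (_∈_)
open import Data.List.Relation.Unary.Unique.Propositional using (Unique)
open import Data.Empty using (⊥)
open import Relation.Nullary using (¬_; does)
open import Relation.Binary.PropositionalEquality using (_≡_; _≢_)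
import Data.Fin as Fin

sumFin : (m : ℕ) → (Fin m → ℕ) → ℕ
sumFin zero    f = 0
sumFin (suc m) f = f fz + sumFin m (λ i → f (fs i))

sumFinℤ : (m : ℕ) → (Fin m → ℤ) → ℤ
sumFinℤ zero    f = + 0
sumFinℤ (suc m) f = f fz ℤ.+ sumFinℤ m (λ i → f (fs i))

anyFin : (m : ℕ) → (Fin m → Bool) → Bool
anyFin zero    f = false
anyFin (suc m) f = f fz ∨ anyFin m (λ i → f (fs i))

boolToℕ : Bool → ℕ
boolToℕ true  = 1
boolToℕ false = 0

-- Vertices: n boundary vertices b_1..b_n (inj₁, labelled clockwise by
-- their index) and k internal vertices (inj₂).

Vtx : ℕ → ℕ → Set
Vtx n k = Fin n ⊎ Fin k

sumV : ∀ {n k} → (Vtx n k → ℕ) → ℕ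
sumV {n} {k} f = sumFin n (λ i → f (inj₁ i)) + sumFin k (λ j → f (inj₂ j))

anyV : ∀ {n k} → (Vtx n k → Bool) → Bool
anyV {n} {k} f = anyFin n (λ i → f (inj₁ i)) ∨ anyFin k (λ j → f (inj₂ j))

_≟V_ : ∀ {n k} → Vtx n k → Vtx n k → Bool
inj₁ i ≟V inj₁ i′ = does (i Fin.≟ i′)
inj₂ j ≟V inj₂ j′ = does (j Fin.≟ j′)
_      ≟V _       = false

index : ∀ {n k} → Vtx n k → ℕ
index {n} (inj₁ i) = toℕ i
index {n} (inj₂ j) = n + toℕ j

record GGraph (n : ℕ) : Set where
  field
    k   : ℕ
    adj : Vtx n k → Vtx n k → Bool
    h   : Fin k → ℕ

  V : Set
  V = Vtx n k

  deg : V → ℕ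
  deg v = sumV (λ w → boolToℕ (adj v w))

  Adj : V → V → Set
  Adj v w = adj v w ≡ true

  data Walk : V → V → Set where
    stop : ∀ {v} → Walk v v
    step : ∀ {u v w} → Adj u v → Walk v w → Walk u w

  verts : ∀ {u v} → Walk u v → List V
  verts {u} stop       = u ∷ []
  verts {u} (step e w) = u ∷ verts w

  tailVerts : ∀ {u v} → Walk u v → List V
  tailVerts stop       = []
  tailVerts (step e w) = verts w

  HasCycle : Set
  HasCycle = Σ V λ x → Σ (Walk x x) λ w → (3 ≤ length (tailVerts w)) × Unique (tailVerts w)

  IsBoundaryLeaf : Fin k → Set
  IsBoundaryLeaf j = deg (inj₂ j) ≡ 1 × ∃[ i ] Adj (inj₂ j) (inj₁ i)

  White : Fin k → Set
  White j = h j ≡ 1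

  Black : Fin k → Set
  Black j = h j ≡ deg (inj₂ j) ∸ 1

  isGeneric : Fin k → Bool
  isGeneric j = not (h j ≡ᵇ 1) ∧ not (h j ≡ᵇ (deg (inj₂ j) ∸ 1))

  mv : Fin k → ℕ
  mv j = if isGeneric j then 2 * deg (inj₂ j) ∸ 4 else deg (inj₂ j) ∸ 1

  reachIn : ℕ → V → V → Bool
  reachIn zero    u v = u ≟V v
  reachIn (suc s) u v = reachIn s u v ∨ anyV (λ w → adj u w ∧ reachIn s w v)

  -- same connected component (walks of length ≤ #vertices suffice)
  conn : V → V → Bool
  conn = reachIn (n + k)

  isRep : V → Bool
  isRep v = not (anyV (λ u → (index u <ᵇ index v) ∧ conn u v))

  -- dim_M of the connected component containing v, viewed as a
  -- Grassmannian tree on its own boundary vertices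
  compDim : V → ℤ
  compDim v =
    let nb = sumFin n (λ i → boolToℕ (conn v (inj₁ i))) in
    if nb ≤ᵇ 2
      then (+ nb) ℤ.- (+ 1)
      else (+ 1) ℤ.+ sumFinℤ k (λ j → if conn v (inj₂ j)
                                        then (+ mv j) ℤ.- (+ 1)
                                        else + 0)

  dimM : ℤ
  dimM = sumFinℤ n (λ i → if isRep (inj₁ i) then compDim (inj₁ i) else + 0)
       ℤ.+ sumFinℤ k (λ j → if isRep (inj₂ j) then compDim (inj₂ j) else + 0)

open GGraph public

record IsGForest {n : ℕ} (G : GGraph n) : Set where
  field
    adj-sym    : ∀ u v → adj G u v ≡ adj G v u
    adj-irrefl : ∀ v → adj G v v ≡ false
    bdry-deg   : ∀ i → deg G (inj₁ i) ≡ 1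
    no-deg2    : ∀ v → deg G v ≢ 2
    to-bdry    : ∀ j → ∃[ i ] Walk G (inj₂ j) (inj₁ i)
    helicity   : ∀ j → (IsBoundaryLeaf G j → h G j ≤ 1)
                     × (¬ IsBoundaryLeaf G j → 1 ≤ h G j × h G j + 1 ≤ deg G (inj₂ j))
    acyclic    : ¬ HasCycle G
    -- planar embedding in the disk with b_1..b_n clockwise on the circle:
    -- walks joining cyclically interleaved boundary vertices must meet
    planar     : ∀ (a b c d : Fin n) → toℕ a < toℕ b → toℕ b < toℕ c → toℕ c < toℕ d →
                 (P : Walk G (inj₁ a) (inj₁ c)) → (Q : Walk G (inj₁ b) (inj₁ d)) →
                 ∃[ v ] (v ∈ verts G P × v ∈ verts G Q)

record GForest (n : ℕ) : Set where
  field
    graph    : GGraph n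
    isForest : IsGForest graph

open GForest public

dimF : ∀ {n} → GForest n → ℤ
dimF F = dimM (graph F)

liftV : ∀ {n k k′} → (Fin k → Fin k′) → Vtx n k → Vtx n k′
liftV φ (inj₁ i) = inj₁ i
liftV φ (inj₂ j) = inj₂ (φ j)

-- G is obtained from F by contracting two adjacent internal white
-- (resp. black) vertices v₁ v₂ into a single white (resp. black) vertex;
-- φ maps internal vertices of F to internal vertices of G (identifying
-- exactly v₁ and v₂), boundary vertices are fixed.
record Contraction {n : ℕ} (F G : GGraph n) : Set where
  field
    v₁ v₂   : Fin (k F)
    adj₁₂   : Adj F (inj₂ v₁) (inj₂ v₂)
    φ       : Fin (k F) → Fin (k G)
    φ-merge : φ v₁ ≡ φ v₂
    φ-inj   : ∀ a b → φ a ≡ φ b → a ≡ b ⊎ ((a ≡ v₁ ⊎ a ≡ v₂) × (b ≡ v₁ ⊎ b ≡ v₂))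
    φ-surj  : ∀ c → ∃[ a ] φ a ≡ c
    adj-to  : ∀ x y → Adj G x y →
              (x ≢ y) × ∃[ x′ ] ∃[ y′ ] (liftV φ x′ ≡ x × liftV φ y′ ≡ y × Adj F x′ y′)
    adj-fro : ∀ x′ y′ → Adj F x′ y′ → liftV φ x′ ≢ liftV φ y′ → Adj G (liftV φ x′) (liftV φ y′)
    h-keep  : ∀ a → a ≢ v₁ → a ≢ v₂ → h G (φ a) ≡ h F a
    colour  : (White F v₁ × White F v₂ × White G (φ v₁))
            ⊎ (Black F v₁ × Black F v₂ × Black G (φ v₁))

record Iso {n : ℕ} (F G : GGraph n) : Set where
  field
    φ      : Fin (k F) → Fin (k G)
    ψ      : Fin (k G) → Fin (k F)
    ψφ     : ∀ a → ψ (φ a) ≡ a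
    φψ     : ∀ c → φ (ψ c) ≡ c
    adj-eq : ∀ x y → adj G (liftV φ x) (liftV φ y) ≡ adj F x y
    h-eq   : ∀ a → h G (φ a) ≡ h F a

data Move {n : ℕ} (F G : GForest n) : Set where
  contract : Contraction (graph F) (graph G) → Move F G
  expand   : Contraction (graph G) (graph F) → Move F G
  relabel  : Iso (graph F) (graph G) → Move F G

-- refinement-equivalence: equivalence closure (through Grassmannian
-- forests) of contraction moves, graphs taken up to isomorphism
data RefEquiv {n : ℕ} : GForest n → GForest n → Set where
  ε   : ∀ {F} → RefEquiv F F
  _◅_ : ∀ {F G H} → Move F G → RefEquiv G H → RefEquiv F H

-- dim_M of a forest is a sum over its components, and the contribution of a component depends
-- only on which boundary vertices it contains and on its weight, the sum of m(v) − 1 over its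
-- internal vertices.  A relabelling preserves both.  Contracting adjacent white (or black)
-- vertices v₁, v₂ into v preserves connectivity and every other degree; as a forest has no
-- triangles, v₁ and v₂ have no common neighbour, so deg v = deg v₁ + deg v₂ − 2.  The three
-- vertices are non-generic, so m = deg − 1 on them and m(v) − 1 = (m(v₁) − 1) + (m(v₂) − 1):
-- every component keeps its weight.

module Submission where

open import Defs
open import Level using (0ℓ)
open import Algebra.Bundles using (CommutativeMonoid)
open import Algebra.Structures using (IsCommutativeMonoid)
import Algebra.Properties.CommutativeSemigroup as CommSemigroupProps
open import Data.Nat as ℕ using (ℕ; zero; suc; _≤_; _∸_; _*_; z≤n; s≤s; _<ᵇ_; _≤ᵇ_; _≡ᵇ_; _<?_)
import Data.Nat.Properties as ℕP
open import Data.Integer as ℤ using (ℤ; +_)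
import Data.Integer.Properties as ℤP
open import Data.Integer.Tactic.RingSolver using (solve-∀)
open import Data.Fin as Fin using (Fin; toℕ; splitAt; join) renaming (zero to fz; suc to fs)
import Data.Fin.Properties as FinP
import Data.Fin.Permutation as Perm
open import Data.Sum using (_⊎_; inj₁; inj₂)
open import Data.Sum.Properties using (inj₁-injective; inj₂-injective; ≡-dec)
open import Data.Bool using (Bool; true; false; _∧_; _∨_; not; if_then_else_)
open import Data.Bool.Properties using (⇔→≡; ¬-not; ∨-identityʳ)
open import Data.Product using (Σ; ∃; _×_; _,_; proj₁; proj₂)
open import Data.Empty using (⊥)
open import Data.List using (List; []; _∷_; length; lookup)
open import Data.List.Relation.Unary.Any using (here; there)
import Data.List.Relation.Unary.Any as Any
open import Data.List.Relation.Unary.All using ([]; _∷_)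
import Data.List.Relation.Unary.All as All
open import Data.List.Relation.Unary.All.Properties using (¬Any⇒All¬)
open import Data.List.Relation.Unary.AllPairs using ([]; _∷_)
open import Data.List.Membership.Propositional using (_∈_)
open import Data.List.Membership.Propositional.Properties using (∈-lookup)
open import Data.List.Relation.Unary.Unique.Propositional using (Unique)
open import Function using (_∘_; id; mk⇔)
open import Relation.Nullary using (Dec; does; yes; no; ¬_; contradiction)
open import Relation.Nullary.Decidable using (dec-true; dec-false)
open import Relation.Unary using (Pred; Decidable)
open import Relation.Binary.PropositionalEquality
  using (_≡_; _≢_; refl; sym; trans; cong; cong₂; subst; subst₂; module ≡-Reasoning)

record Collapses {m p : ℕ} (φ : Fin m → Fin p) (v₁ v₂ : Fin m) : Set where
  field
    distinct : v₁ ≢ v₂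
    merge    : φ v₁ ≡ φ v₂
    only     : ∀ a b → φ a ≡ φ b → a ≡ b ⊎ ((a ≡ v₁ ⊎ a ≡ v₂) × (b ≡ v₁ ⊎ b ≡ v₂))
    onto     : ∀ c → ∃ λ a → φ a ≡ c

module FiniteSum {A : Set} (_∙_ : A → A → A) (0# : A) (isCM : IsCommutativeMonoid _≡_ _∙_ 0#)
  (Σᶠ : ∀ m → (Fin m → A) → A)
  (Σᶠ-zero : ∀ f → Σᶠ zero f ≡ 0#)
  (Σᶠ-suc : ∀ m f → Σᶠ (suc m) f ≡ f fz ∙ Σᶠ m (f ∘ fs))
  where

  private
    commutativeMonoid : CommutativeMonoid 0ℓ 0ℓ
    commutativeMonoid = record { isCommutativeMonoid = isCM }

  open IsCommutativeMonoid isCM using (identityˡ; identityʳ)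
  open import Algebra.Properties.CommutativeMonoid.Sum commutativeMonoid
    using (sum; sum-cong-≗; sum-replicate-zero; ∑-distrib-+; ∑-comm; ∑-permute)
  open ≡-Reasoning

  infix 21 [_]·_
  [_]·_ : Bool → A → A
  [ b ]· x = if b then x else 0#

  private
    Σᶠ≡sum : ∀ m f → Σᶠ m f ≡ sum f
    Σᶠ≡sum zero    f = Σᶠ-zero f
    Σᶠ≡sum (suc m) f = trans (Σᶠ-suc m f) (cong (f fz ∙_) (Σᶠ≡sum m (f ∘ fs)))

  Σᶠ-cong : ∀ m {f g} → (∀ i → f i ≡ g i) → Σᶠ m f ≡ Σᶠ m g
  Σᶠ-cong m {f} {g} f≗g = begin
    Σᶠ m f ≡⟨ Σᶠ≡sum m f ⟩
    sum f  ≡⟨ sum-cong-≗ f≗g ⟩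
    sum g  ≡⟨ Σᶠ≡sum m g ⟨
    Σᶠ m g ∎

  Σᶠ-vanish : ∀ m {f} → (∀ i → f i ≡ 0#) → Σᶠ m f ≡ 0#
  Σᶠ-vanish m f≗0 = trans (Σᶠ-cong m f≗0) (trans (Σᶠ≡sum m _) (sum-replicate-zero m))

  Σᶠ-distrib : ∀ m f g → Σᶠ m (λ i → f i ∙ g i) ≡ Σᶠ m f ∙ Σᶠ m g
  Σᶠ-distrib m f g = begin
    Σᶠ m (λ i → f i ∙ g i) ≡⟨ Σᶠ≡sum m _ ⟩
    sum (λ i → f i ∙ g i)  ≡⟨ ∑-distrib-+ f g ⟩
    sum f ∙ sum g          ≡⟨ cong₂ _∙_ (Σᶠ≡sum m f) (Σᶠ≡sum m g) ⟨
    Σᶠ m f ∙ Σᶠ m g        ∎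

  Σᶠ-comm : ∀ m p (f : Fin m → Fin p → A) →
            Σᶠ m (λ a → Σᶠ p (f a)) ≡ Σᶠ p (λ c → Σᶠ m (λ a → f a c))
  Σᶠ-comm m p f = begin
    Σᶠ m (λ a → Σᶠ p (f a))          ≡⟨ Σᶠ-cong m (λ a → Σᶠ≡sum p (f a)) ⟩
    Σᶠ m (λ a → sum (f a))           ≡⟨ Σᶠ≡sum m _ ⟩
    sum (λ a → sum (f a))            ≡⟨ ∑-comm f ⟩
    sum (λ c → sum (λ a → f a c))    ≡⟨ Σᶠ≡sum p _ ⟨
    Σᶠ p (λ c → sum (λ a → f a c))   ≡⟨ Σᶠ-cong p (λ c → Σᶠ≡sum m _) ⟨
    Σᶠ p (λ c → Σᶠ m (λ a → f a c))  ∎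

  Σᶠ-reindex : ∀ m p (φ : Fin m → Fin p) (ψ : Fin p → Fin m) →
               (∀ a → ψ (φ a) ≡ a) → (∀ c → φ (ψ c) ≡ c) →
               ∀ f g → (∀ a → g (φ a) ≡ f a) → Σᶠ m f ≡ Σᶠ p g
  Σᶠ-reindex m p φ ψ ψφ φψ f g g∘φ≗f = begin
    Σᶠ m f      ≡⟨ Σᶠ≡sum m f ⟩
    sum f       ≡⟨ sum-cong-≗ (sym ∘ g∘φ≗f) ⟩
    sum (g ∘ φ) ≡⟨ ∑-permute g (Perm.permutation φ ψ φψ ψφ) ⟨
    sum g       ≡⟨ Σᶠ≡sum p g ⟨
    Σᶠ p g      ∎

  []·-yes : ∀ {B : Set} (B? : Dec B) x → B → [ does B? ]· x ≡ x
  []·-yes B? x b = cong ([_]· x) (dec-true B? b)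

  []·-no : ∀ {B : Set} (B? : Dec B) x → ¬ B → [ does B? ]· x ≡ 0#
  []·-no B? x ¬b = cong ([_]· x) (dec-false B? ¬b)

  Σᶠ-unique : ∀ m {P : Pred (Fin m) 0ℓ} (P? : Decidable P) (f : Fin m → A) {a₀} →
              (∀ a → P a → a ≡ a₀) → P a₀ → Σᶠ m (λ a → [ does (P? a) ]· f a) ≡ f a₀
  Σᶠ-unique (suc m) P? f {fz} only Pa₀ = begin
    Σᶠ (suc m) (λ a → [ does (P? a) ]· f a)
      ≡⟨ Σᶠ-suc m (λ a → [ does (P? a) ]· f a) ⟩
    [ does (P? fz) ]· f fz ∙ Σᶠ m (λ a → [ does (P? (fs a)) ]· f (fs a))
      ≡⟨ cong₂ _∙_ ([]·-yes (P? fz) (f fz) Pa₀)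
                   (Σᶠ-vanish m (λ a → []·-no (P? (fs a)) (f (fs a)) (fs≢fz ∘ only (fs a)))) ⟩
    f fz ∙ 0#
      ≡⟨ identityʳ (f fz) ⟩
    f fz ∎
    where
    fs≢fz : ∀ {a} → fs a ≢ fz
    fs≢fz ()
  Σᶠ-unique (suc m) P? f {fs a₀} only Pa₀ = begin
    Σᶠ (suc m) (λ a → [ does (P? a) ]· f a)
      ≡⟨ Σᶠ-suc m (λ a → [ does (P? a) ]· f a) ⟩
    [ does (P? fz) ]· f fz ∙ Σᶠ m (λ a → [ does (P? (fs a)) ]· f (fs a))
      ≡⟨ cong₂ _∙_ ([]·-no (P? fz) (f fz) (fz≢fs ∘ only fz))
                   (Σᶠ-unique m (P? ∘ fs) (f ∘ fs) (λ a → FinP.suc-injective ∘ only (fs a)) Pa₀) ⟩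
    0# ∙ f (fs a₀)
      ≡⟨ identityˡ (f (fs a₀)) ⟩
    f (fs a₀) ∎
    where
    fz≢fs : fz ≢ fs a₀
    fz≢fs ()

  Σᶠ-fibres : ∀ m p (φ : Fin m → Fin p) (f : Fin m → A) →
              Σᶠ m f ≡ Σᶠ p (λ c → Σᶠ m (λ a → [ does (φ a Fin.≟ c) ]· f a))
  Σᶠ-fibres m p φ f = begin
    Σᶠ m f                                                  ≡⟨ Σᶠ-cong m fibre ⟨
    Σᶠ m (λ a → Σᶠ p (λ c → [ does (φ a Fin.≟ c) ]· f a))   ≡⟨ Σᶠ-comm m p _ ⟩
    Σᶠ p (λ c → Σᶠ m (λ a → [ does (φ a Fin.≟ c) ]· f a))   ∎
    where
    fibre : ∀ a → Σᶠ p (λ c → [ does (φ a Fin.≟ c) ]· f a) ≡ f a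
    fibre a = Σᶠ-unique p (φ a Fin.≟_) (λ _ → f a) (λ _ → sym) refl

  Σᶠ-collapse : ∀ {m p} {φ : Fin m → Fin p} {v₁ v₂} → Collapses φ v₁ v₂ →
                ∀ f g → (∀ a → a ≢ v₁ → a ≢ v₂ → g (φ a) ≡ f a) → g (φ v₁) ≡ f v₁ ∙ f v₂ →
                Σᶠ m f ≡ Σᶠ p g
  Σᶠ-collapse {m} {p} {φ} {v₁} {v₂} φ-collapses f g g≡f g≡f₁∙f₂ =
    trans (Σᶠ-fibres m p φ f) (Σᶠ-cong p fibreSum≡g)
    where
    open Collapses φ-collapses
    fibreSum : Fin p → A
    fibreSum c = Σᶠ m (λ a → [ does (φ a Fin.≟ c) ]· f a)

    split : ∀ a → [ does (φ a Fin.≟ φ v₁) ]· f a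
                ≡ [ does (a Fin.≟ v₁) ]· f a ∙ [ does (a Fin.≟ v₂) ]· f a
    split a with a Fin.≟ v₁ | a Fin.≟ v₂ | φ a Fin.≟ φ v₁
    ... | yes refl | yes a≡v₂  | _         = contradiction a≡v₂ distinct
    ... | yes refl | no _      | yes _     = sym (identityʳ (f a))
    ... | yes refl | no _      | no φa≢φa  = contradiction refl φa≢φa
    ... | no _     | yes refl  | yes _     = sym (identityˡ (f a))
    ... | no _     | yes refl  | no φa≢φv₁ = contradiction (sym merge) φa≢φv₁
    ... | no _     | no _      | no _      = sym (identityˡ 0#)
    ... | no a≢v₁  | no a≢v₂   | yes φa≡φv₁ with only a v₁ φa≡φv₁
    ...   | inj₁ a≡v₁            = contradiction a≡v₁ a≢v₁
    ...   | inj₂ (inj₁ a≡v₁ , _) = contradiction a≡v₁ a≢v₁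
    ...   | inj₂ (inj₂ a≡v₂ , _) = contradiction a≡v₂ a≢v₂

    merged : fibreSum (φ v₁) ≡ g (φ v₁)
    merged = begin
      fibreSum (φ v₁)
        ≡⟨ Σᶠ-cong m split ⟩
      Σᶠ m (λ a → [ does (a Fin.≟ v₁) ]· f a ∙ [ does (a Fin.≟ v₂) ]· f a)
        ≡⟨ Σᶠ-distrib m _ _ ⟩
      Σᶠ m (λ a → [ does (a Fin.≟ v₁) ]· f a) ∙ Σᶠ m (λ a → [ does (a Fin.≟ v₂) ]· f a)
        ≡⟨ cong₂ _∙_ (Σᶠ-unique m (Fin._≟ v₁) f (λ _ → id) refl)
                     (Σᶠ-unique m (Fin._≟ v₂) f (λ _ → id) refl) ⟩
      f v₁ ∙ f v₂
        ≡⟨ g≡f₁∙f₂ ⟨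
      g (φ v₁) ∎

    kept : ∀ a₀ → a₀ ≢ v₁ → a₀ ≢ v₂ → fibreSum (φ a₀) ≡ g (φ a₀)
    kept a₀ a₀≢v₁ a₀≢v₂ =
      trans (Σᶠ-unique m (λ a → φ a Fin.≟ φ a₀) f injective refl) (sym (g≡f a₀ a₀≢v₁ a₀≢v₂))
      where
      injective : ∀ a → φ a ≡ φ a₀ → a ≡ a₀
      injective a φa≡φa₀ with only a a₀ φa≡φa₀
      ... | inj₁ a≡a₀             = a≡a₀
      ... | inj₂ (_ , inj₁ a₀≡v₁) = contradiction a₀≡v₁ a₀≢v₁
      ... | inj₂ (_ , inj₂ a₀≡v₂) = contradiction a₀≡v₂ a₀≢v₂

    fibreSum≡g : ∀ c → fibreSum c ≡ g c
    fibreSum≡g c with onto c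
    ... | a₀ , refl with a₀ Fin.≟ v₁ | a₀ Fin.≟ v₂
    ...   | yes refl | _        = merged
    ...   | no _     | yes refl = subst (λ x → fibreSum x ≡ g x) merge merged
    ...   | no ≢v₁   | no ≢v₂   = kept a₀ ≢v₁ ≢v₂

∨-trueˡ : ∀ {a} b → a ≡ true → a ∨ b ≡ true
∨-trueˡ _ refl = refl

∨-trueʳ : ∀ a {b} → b ≡ true → a ∨ b ≡ true
∨-trueʳ true  _    = refl
∨-trueʳ false refl = refl

∨-true⁻ : ∀ a {b} → a ∨ b ≡ true → a ≡ true ⊎ b ≡ true
∨-true⁻ true  _ = inj₁ refl
∨-true⁻ false e = inj₂ e

∧-true⁻ : ∀ a {b} → a ∧ b ≡ true → a ≡ true × b ≡ true
∧-true⁻ true e = refl , e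

anyFin⁺ : ∀ m (f : Fin m → Bool) i → f i ≡ true → anyFin m f ≡ true
anyFin⁺ (suc m) f fz     e = ∨-trueˡ _ e
anyFin⁺ (suc m) f (fs i) e = ∨-trueʳ (f fz) (anyFin⁺ m (f ∘ fs) i e)

anyFin⁻ : ∀ m (f : Fin m → Bool) → anyFin m f ≡ true → ∃ λ i → f i ≡ true
anyFin⁻ (suc m) f e with ∨-true⁻ (f fz) e
... | inj₁ f0 = fz , f0
... | inj₂ rest with anyFin⁻ m (f ∘ fs) rest
...   | i , fi = fs i , fi

anyFin-cong : ∀ m {f g : Fin m → Bool} → (∀ i → f i ≡ g i) → anyFin m f ≡ anyFin m g
anyFin-cong zero    f≡g = refl
anyFin-cong (suc m) f≡g = cong₂ _∨_ (f≡g fz) (anyFin-cong m (f≡g ∘ fs))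

anyFin-false : ∀ m (f : Fin m → Bool) → (∀ i → f i ≡ false) → anyFin m f ≡ false
anyFin-false zero    f f≡false = refl
anyFin-false (suc m) f f≡false rewrite f≡false fz = anyFin-false m (f ∘ fs) (f≡false ∘ fs)

module _ {n k : ℕ} where

  anyV⁺ : (f : Vtx n k → Bool) → ∀ x → f x ≡ true → anyV f ≡ true
  anyV⁺ f (inj₁ i) e = ∨-trueˡ _ (anyFin⁺ n (f ∘ inj₁) i e)
  anyV⁺ f (inj₂ j) e = ∨-trueʳ _ (anyFin⁺ k (f ∘ inj₂) j e)

  anyV⁻ : (f : Vtx n k → Bool) → anyV f ≡ true → ∃ λ x → f x ≡ true
  anyV⁻ f e with ∨-true⁻ (anyFin n (f ∘ inj₁)) e
  ... | inj₁ bdry with anyFin⁻ n (f ∘ inj₁) bdry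
  ...   | i , fi = inj₁ i , fi
  anyV⁻ f e | inj₂ int with anyFin⁻ k (f ∘ inj₂) int
  ...   | j , fj = inj₂ j , fj

  _≟ᵛ_ : (x y : Vtx n k) → Dec (x ≡ y)
  _≟ᵛ_ = ≡-dec Fin._≟_ Fin._≟_

  ≟V-refl : (x : Vtx n k) → (x ≟V x) ≡ true
  ≟V-refl (inj₁ i) = dec-true (i Fin.≟ i) refl
  ≟V-refl (inj₂ j) = dec-true (j Fin.≟ j) refl

  ≟V-sound : (x y : Vtx n k) → (x ≟V y) ≡ true → x ≡ y
  ≟V-sound (inj₁ i) (inj₁ i′) e with i Fin.≟ i′
  ... | yes refl = refl
  ≟V-sound (inj₂ j) (inj₂ j′) e with j Fin.≟ j′
  ... | yes refl = refl

  Unique⇒length≤ : (xs : List (Vtx n k)) → Unique xs → length xs ≤ n ℕ.+ k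
  Unique⇒length≤ xs u = FinP.injective⇒≤ {f = join n k ∘ lookup xs}
    (λ {i} {j} e → lookup-injective u i j (trans (sym (FinP.splitAt-join n k _))
                                            (trans (cong (splitAt n) e) (FinP.splitAt-join n k _))))
    where
    lookup-injective : ∀ {xs : List (Vtx n k)} → Unique xs → ∀ i j → lookup xs i ≡ lookup xs j → i ≡ j
    lookup-injective (x∉xs ∷ u) fz     fz     e = refl
    lookup-injective (x∉xs ∷ u) fz     (fs j) e = contradiction e (All.lookup x∉xs (∈-lookup j))
    lookup-injective (x∉xs ∷ u) (fs i) fz     e = contradiction (sym e) (All.lookup x∉xs (∈-lookup i))
    lookup-injective (x∉xs ∷ u) (fs i) (fs j) e = cong fs (lookup-injective u i j e)

module WalkProperties {n : ℕ} (G : GGraph n) where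

  steps : ∀ {u v} → Walk G u v → ℕ
  steps stop       = 0
  steps (step _ w) = suc (steps w)

  length-verts : ∀ {u v} (w : Walk G u v) → length (verts G w) ≡ suc (steps w)
  length-verts stop       = refl
  length-verts (step _ w) = cong suc (length-verts w)

  infixr 5 _++ʷ_
  _++ʷ_ : ∀ {u v w} → Walk G u v → Walk G v w → Walk G u w
  stop     ++ʷ q = q
  step e p ++ʷ q = step e (p ++ʷ q)

  reverse : (∀ u v → adj G u v ≡ adj G v u) → ∀ {u v} → Walk G u v → Walk G v u
  reverse adj-sym stop               = stop
  reverse adj-sym (step {u} {v} e w) = reverse adj-sym w ++ʷ step (trans (adj-sym v u) e) stop

  reachIn-refl : ∀ s u → reachIn G s u u ≡ true
  reachIn-refl zero    u = ≟V-refl u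
  reachIn-refl (suc s) u = ∨-trueˡ _ (reachIn-refl s u)

  reachIn-complete : ∀ s {u v} (w : Walk G u v) → steps w ≤ s → reachIn G s u v ≡ true
  reachIn-complete s       stop                   _         = reachIn-refl s _
  reachIn-complete (suc s) {u} {v} (step {v = x} e w) (s≤s w≤s) =
    ∨-trueʳ (reachIn G s u v)
      (anyV⁺ (λ y → adj G u y ∧ reachIn G s y v) x (cong₂ _∧_ e (reachIn-complete s w w≤s)))

  reachIn-sound : ∀ s {u v} → reachIn G s u v ≡ true → Walk G u v
  reachIn-sound zero    {u} {v} e = subst (Walk G u) (≟V-sound u v e) stop
  reachIn-sound (suc s) {u} {v} e with ∨-true⁻ (reachIn G s u v) e
  ... | inj₁ shorter = reachIn-sound s shorter
  ... | inj₂ further with anyV⁻ (λ y → adj G u y ∧ reachIn G s y v) further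
  ...   | x , ux∧xv with ∧-true⁻ (adj G u x) ux∧xv
  ...     | ux , xv = step ux (reachIn-sound s xv)

  suffix : ∀ {x u v} (w : Walk G u v) → x ∈ verts G w → Walk G x v
  suffix stop       (here refl) = stop
  suffix (step e w) (here refl) = step e w
  suffix (step e w) (there x∈w) = suffix w x∈w

  suffix-Unique : ∀ {x u v} (w : Walk G u v) (x∈w : x ∈ verts G w) →
                  Unique (verts G w) → Unique (verts G (suffix w x∈w))
  suffix-Unique stop       (here refl) u       = u
  suffix-Unique (step e w) (here refl) u       = u
  suffix-Unique (step e w) (there x∈w) (_ ∷ u) = suffix-Unique w x∈w u

  path : ∀ {u v} → Walk G u v → Σ (Walk G u v) (Unique ∘ verts G)
  path stop = stop , [] ∷ []
  path {u} (step e w) with path w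
  ... | p , p-Unique with Any.any? (u ≟ᵛ_) (verts G p)
  ...   | yes u∈p = suffix p u∈p , suffix-Unique p u∈p p-Unique
  ...   | no  u∉p = step e p , ¬Any⇒All¬ (verts G p) u∉p ∷ p-Unique

  -- conn only explores walks of at most n + k steps; a path, having distinct vertices, is that short.
  conn-complete : ∀ {u v} → Walk G u v → conn G u v ≡ true
  conn-complete w with path w
  ... | p , p-Unique = reachIn-complete (n ℕ.+ k G) p (ℕP.≤-trans (ℕP.n≤1+n (steps p)) 1+steps≤n+k)
    where
    1+steps≤n+k : suc (steps p) ≤ n ℕ.+ k G
    1+steps≤n+k = subst (_≤ n ℕ.+ k G) (length-verts p) (Unique⇒length≤ (verts G p) p-Unique)

  conn-sound : ∀ {u v} → conn G u v ≡ true → Walk G u v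
  conn-sound = reachIn-sound (n ℕ.+ k G)

conn-≡ : ∀ {n} {G H : GGraph n} {x y X Y} →
         (Walk G x y → Walk H X Y) → (Walk H X Y → Walk G x y) → conn G x y ≡ conn H X Y
conn-≡ {G = G} {H} to from = ⇔→≡ (mk⇔ (WalkProperties.conn-complete H ∘ to ∘ WalkProperties.conn-sound G)
                                      (WalkProperties.conn-complete G ∘ from ∘ WalkProperties.conn-sound H))

module ℕΣ = FiniteSum ℕ._+_ 0 ℕP.+-0-isCommutativeMonoid sumFin (λ _ → refl) (λ _ _ → refl)
module ℤΣ = FiniteSum ℤ._+_ (+ 0) ℤP.+-0-isCommutativeMonoid sumFinℤ (λ _ → refl) (λ _ _ → refl)

weightTerm : ∀ {n} (G : GGraph n) → Fin n → Fin (k G) → ℤ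
weightTerm G i j = if conn G (inj₁ i) (inj₂ j) then (+ mv G j) ℤ.- (+ 1) else + 0

componentWeight : ∀ {n} → GGraph n → Fin n → ℤ
componentWeight G i = sumFinℤ (k G) (weightTerm G i)

weightTerm-cong : ∀ {n} (G H : GGraph n) {i j j′} →
                  conn G (inj₁ i) (inj₂ j) ≡ conn H (inj₁ i) (inj₂ j′) → mv G j ≡ mv H j′ →
                  weightTerm G i j ≡ weightTerm H i j′
weightTerm-cong _ _ conn≡ mv≡ = cong₂ (λ b m → if b then (+ m) ℤ.- (+ 1) else + 0) conn≡ mv≡

mv-cong : ∀ {n n′} (G : GGraph n) (H : GGraph n′) {j j′} →
          h G j ≡ h H j′ → deg G (inj₂ j) ≡ deg H (inj₂ j′) → mv G j ≡ mv H j′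
mv-cong _ _ = cong₂ (λ hᵥ d → if not (hᵥ ≡ᵇ 1) ∧ not (hᵥ ≡ᵇ (d ∸ 1)) then 2 * d ∸ 4 else d ∸ 1)

isRep-inj₁ : ∀ {n} (G : GGraph n) i →
             isRep G (inj₁ i) ≡ not (anyFin n (λ i′ → (toℕ i′ <ᵇ toℕ i) ∧ conn G (inj₁ i′) (inj₁ i)))
isRep-inj₁ {n} G i =
  cong not (trans (cong (earlierBoundary ∨_) (anyFin-false (k G) _ internal-later)) (∨-identityʳ earlierBoundary))
  where
  earlierBoundary : Bool
  earlierBoundary = anyFin n (λ i′ → (toℕ i′ <ᵇ toℕ i) ∧ conn G (inj₁ i′) (inj₁ i))
  internal-later : ∀ j → ((n ℕ.+ toℕ j) <ᵇ toℕ i) ∧ conn G (inj₂ j) (inj₁ i) ≡ false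
  internal-later j = cong (_∧ conn G (inj₂ j) (inj₁ i))
    (dec-false (_ <? _) (ℕP.≤⇒≯ (ℕP.≤-trans (ℕP.<⇒≤ (FinP.toℕ<n i)) (ℕP.m≤m+n n (toℕ j)))))

module _ {n : ℕ} (F : GForest n) where
  private
    G : GGraph n
    G = graph F
  open IsGForest (isForest F)
  open WalkProperties G

  isRep-inj₂ : ∀ j → isRep G (inj₂ j) ≡ false
  isRep-inj₂ j with to-bdry j
  ... | i , j⇝i = cong not (anyV⁺ (λ u → (index u <ᵇ index {n} (inj₂ j)) ∧ conn G u (inj₂ j)) (inj₁ i)
                     (cong₂ _∧_ (dec-true (_ <? _) (ℕP.<-≤-trans (FinP.toℕ<n i) (ℕP.m≤m+n n (toℕ j))))
                                (conn-complete (reverse adj-sym j⇝i))))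

  dimF≡boundarySum : dimF F ≡ sumFinℤ n (λ i → if isRep G (inj₁ i) then compDim G (inj₁ i) else + 0)
  dimF≡boundarySum = trans (cong (ℤ._+_ boundarySum) internalSum≡0) (ℤP.+-identityʳ boundarySum)
    where
    internalSum≡0 : sumFinℤ (k G) (λ j → if isRep G (inj₂ j) then compDim G (inj₂ j) else + 0) ≡ + 0
    internalSum≡0 = ℤΣ.Σᶠ-vanish (k G) (λ j → cong (if_then compDim G (inj₂ j) else + 0) (isRep-inj₂ j))
    boundarySum : ℤ
    boundarySum = sumFinℤ n (λ i → if isRep G (inj₁ i) then compDim G (inj₁ i) else + 0)

dimF-≡ : ∀ {n} (F G : GForest n) →
         (∀ i i′ → conn (graph F) (inj₁ i) (inj₁ i′) ≡ conn (graph G) (inj₁ i) (inj₁ i′)) →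
         (∀ i → componentWeight (graph F) i ≡ componentWeight (graph G) i) →
         dimF F ≡ dimF G
dimF-≡ {n} F G conn≡ weight≡ = begin
  dimF F                                                               ≡⟨ dimF≡boundarySum F ⟩
  sumFinℤ n (λ i → if isRep GF (inj₁ i) then compDim GF (inj₁ i) else + 0) ≡⟨ ℤΣ.Σᶠ-cong n summand≡ ⟩
  sumFinℤ n (λ i → if isRep GG (inj₁ i) then compDim GG (inj₁ i) else + 0) ≡⟨ dimF≡boundarySum G ⟨
  dimF G                                                               ∎
  where
  open ≡-Reasoning
  GF GG : GGraph n
  GF = graph F
  GG = graph G
  isRep≡ : ∀ i → isRep GF (inj₁ i) ≡ isRep GG (inj₁ i)
  isRep≡ i = trans (isRep-inj₁ GF i)
    (trans (cong not (anyFin-cong n (λ i′ → cong ((toℕ i′ <ᵇ toℕ i) ∧_) (conn≡ i′ i))))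
           (sym (isRep-inj₁ GG i)))
  compDim≡ : ∀ i → compDim GF (inj₁ i) ≡ compDim GG (inj₁ i)
  compDim≡ i = cong₂ (λ nb w → if nb ≤ᵇ 2 then (+ nb) ℤ.- (+ 1) else (+ 1) ℤ.+ w)
                     (ℕΣ.Σᶠ-cong n (λ i′ → cong boolToℕ (conn≡ i i′))) (weight≡ i)
  summand≡ : ∀ i → (if isRep GF (inj₁ i) then compDim GF (inj₁ i) else + 0)
                 ≡ (if isRep GG (inj₁ i) then compDim GG (inj₁ i) else + 0)
  summand≡ i = cong₂ (if_then_else + 0) (isRep≡ i) (compDim≡ i)

module _ {n : ℕ} {G H : GGraph n} (I : Iso G H) where
  open Iso I

  liftV-ψφ : ∀ (x : Vtx n (k G)) → liftV ψ (liftV φ x) ≡ x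
  liftV-ψφ (inj₁ i) = refl
  liftV-ψφ (inj₂ a) = cong inj₂ (ψφ a)

  liftV-φψ : ∀ (x : Vtx n (k H)) → liftV φ (liftV ψ x) ≡ x
  liftV-φψ (inj₁ i) = refl
  liftV-φψ (inj₂ c) = cong inj₂ (φψ c)

  walk-φ : ∀ {x y} → Walk G x y → Walk H (liftV φ x) (liftV φ y)
  walk-φ stop               = stop
  walk-φ (step {u} {v} e w) = step (trans (adj-eq u v) e) (walk-φ w)

  walk-ψ : ∀ {X Y} → Walk H X Y → Walk G (liftV ψ X) (liftV ψ Y)
  walk-ψ stop               = stop
  walk-ψ (step {U} {V} e w) =
    step (trans (sym (adj-eq (liftV ψ U) (liftV ψ V))) (trans (cong₂ (adj H) (liftV-φψ U) (liftV-φψ V)) e))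
         (walk-ψ w)

  conn-φ : ∀ x y → conn G x y ≡ conn H (liftV φ x) (liftV φ y)
  conn-φ x y = conn-≡ walk-φ (subst₂ (Walk G) (liftV-ψφ x) (liftV-ψφ y) ∘ walk-ψ)

  deg-φ : ∀ x → deg H (liftV φ x) ≡ deg G x
  deg-φ x = cong₂ ℕ._+_
    (ℕΣ.Σᶠ-cong n (λ i → cong boolToℕ (adj-eq x (inj₁ i))))
    (sym (ℕΣ.Σᶠ-reindex (k G) (k H) φ ψ ψφ φψ _ _ (λ a → cong boolToℕ (adj-eq x (inj₂ a)))))

  componentWeight-φ : ∀ i → componentWeight G i ≡ componentWeight H i
  componentWeight-φ i = ℤΣ.Σᶠ-reindex (k G) (k H) φ ψ ψφ φψ (weightTerm G i) (weightTerm H i)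
    (λ a → weightTerm-cong H G (sym (conn-φ (inj₁ i) (inj₂ a))) (mv-cong H G (h-eq a) (deg-φ (inj₂ a))))

dimF-relabel : ∀ {n} (F G : GForest n) → Iso (graph F) (graph G) → dimF F ≡ dimF G
dimF-relabel F G I = dimF-≡ F G (λ i i′ → conn-φ I (inj₁ i) (inj₁ i′)) (componentWeight-φ I)

boundaryDeg internalDeg : ∀ {n} (G : GGraph n) → Vtx n (k G) → ℕ
boundaryDeg {n} G x = sumFin n (λ i → boolToℕ (adj G x (inj₁ i)))
internalDeg     G x = sumFin (k G) (λ j → boolToℕ (adj G x (inj₂ j)))

adj⇒1≤deg : ∀ {n} (G : GGraph n) x y → Adj G x y → 1 ≤ deg G x
adj⇒1≤deg {n} G x y e = ℕP.≤-trans (ℕP.≤-reflexive (cong boolToℕ (sym e))) (term≤deg y)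
  where
  term≤sum : ∀ m (f : Fin m → ℕ) i → f i ≤ sumFin m f
  term≤sum (suc m) f fz     = ℕP.m≤m+n _ _
  term≤sum (suc m) f (fs i) = ℕP.≤-trans (term≤sum m (f ∘ fs) i) (ℕP.m≤n+m _ _)
  term≤deg : ∀ y → boolToℕ (adj G x y) ≤ deg G x
  term≤deg (inj₁ i) = ℕP.≤-trans (term≤sum n _ i) (ℕP.m≤m+n _ _)
  term≤deg (inj₂ j) = ℕP.≤-trans (term≤sum (k G) _ j) (ℕP.m≤n+m _ _)

mv-nonGeneric : ∀ {n} (G : GGraph n) j → White G j ⊎ Black G j → mv G j ≡ deg G (inj₂ j) ∸ 1
mv-nonGeneric G j (inj₁ white) rewrite white = refl
-- does (m ℕ.≟ n) unfolds to m ≡ᵇ n, so dec-true evaluates the test h ≡ᵇ deg ∸ 1.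
mv-nonGeneric G j (inj₂ black) with h G j ℕ.≡ᵇ 1
... | true  = refl
... | false rewrite black | dec-true (deg G (inj₂ j) ∸ 1 ℕ.≟ deg G (inj₂ j) ∸ 1) refl = refl

pred∸-merge : ∀ d₁ d₂ d → 1 ≤ d₁ → 1 ≤ d₂ → 1 ≤ d → d ℕ.+ 2 ≡ d₁ ℕ.+ d₂ →
              (+ (d ∸ 1)) ℤ.- (+ 1) ≡ ((+ (d₁ ∸ 1)) ℤ.- (+ 1)) ℤ.+ ((+ (d₂ ∸ 1)) ℤ.- (+ 1))
pred∸-merge (suc a) (suc b) (suc c) _ _ _ eq = begin
  + c ℤ.- + 1                          ≡⟨ shift (+ c) ⟩
  (+ c ℤ.+ + 1) ℤ.- + 1 ℤ.- + 1        ≡⟨ cong (λ t → + t ℤ.- + 1 ℤ.- + 1) c+1≡a+b ⟩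
  (+ a ℤ.+ + b) ℤ.- + 1 ℤ.- + 1        ≡⟨ regroup (+ a) (+ b) ⟩
  (+ a ℤ.- + 1) ℤ.+ (+ b ℤ.- + 1)      ∎
  where
  open ≡-Reasoning
  shift : ∀ x → x ℤ.- + 1 ≡ (x ℤ.+ + 1) ℤ.- + 1 ℤ.- + 1
  shift = solve-∀
  regroup : ∀ x y → (x ℤ.+ y) ℤ.- + 1 ℤ.- + 1 ≡ (x ℤ.- + 1) ℤ.+ (y ℤ.- + 1)
  regroup = solve-∀
  c+1≡a+b : c ℕ.+ 1 ≡ a ℕ.+ b
  c+1≡a+b = ℕP.suc-injective (trans (sym (ℕP.+-suc c 1)) (trans (ℕP.suc-injective eq) (ℕP.+-suc a b)))

module _ {n : ℕ} (F G : GForest n) (C : Contraction (graph F) (graph G)) where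
  open ≡-Reasoning
  private
    GF GG : GGraph n
    GF = graph F
    GG = graph G
    VF : Set
    VF = Vtx n (k GF)
  open Contraction C
  open IsGForest (isForest F) renaming (adj-sym to adj-symF; adj-irrefl to adj-irreflF)
  open IsGForest (isForest G) using () renaming (adj-sym to adj-symG; adj-irrefl to adj-irreflG; to-bdry to to-bdryG)
  open WalkProperties GF using (_++ʷ_)

  private
    lift : VF → Vtx n (k GG)
    lift = liftV φ

    M : Vtx n (k GG)
    M = inj₂ (φ v₁)

    [_~_] : VF → VF → ℕ
    [ x ~ y ] = boolToℕ (adj GF x y)

  v₁≢v₂ : v₁ ≢ v₂
  v₁≢v₂ refl = contradiction (trans (sym (adj-irreflF _)) adj₁₂) λ ()

  φ-collapses : Collapses φ v₁ v₂
  φ-collapses = record { distinct = v₁≢v₂ ; merge = φ-merge ; only = φ-inj ; onto = φ-surj }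

  Merged : VF → Set
  Merged x = x ≡ inj₂ v₁ ⊎ x ≡ inj₂ v₂

  Kept : VF → Set
  Kept x = x ≢ inj₂ v₁ × x ≢ inj₂ v₂

  kept-inj₁ : ∀ i → Kept (inj₁ i)
  kept-inj₁ i = (λ ()) , (λ ())

  kept-inj₂ : ∀ {a} → a ≢ v₁ → a ≢ v₂ → Kept (inj₂ a)
  kept-inj₂ a≢v₁ a≢v₂ = a≢v₁ ∘ inj₂-injective , a≢v₂ ∘ inj₂-injective

  kept-or-merged : ∀ x → Kept x ⊎ Merged x
  kept-or-merged x with x ≟ᵛ inj₂ v₁ | x ≟ᵛ inj₂ v₂
  ... | yes x≡v₁ | _        = inj₂ (inj₁ x≡v₁)
  ... | no _     | yes x≡v₂ = inj₂ (inj₂ x≡v₂)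
  ... | no x≢v₁  | no x≢v₂  = inj₁ (x≢v₁ , x≢v₂)

  lift-merged : ∀ {x} → Merged x → lift x ≡ M
  lift-merged (inj₁ refl) = refl
  lift-merged (inj₂ refl) = cong inj₂ (sym φ-merge)

  lift⁻¹-M : ∀ y → lift y ≡ M → Merged y
  lift⁻¹-M (inj₂ b) e with φ-inj b v₁ (inj₂-injective e)
  ... | inj₁ refl            = inj₁ refl
  ... | inj₂ (inj₁ refl , _) = inj₁ refl
  ... | inj₂ (inj₂ refl , _) = inj₂ refl

  lift⁻¹-kept : ∀ {x} → Kept x → ∀ y → lift y ≡ lift x → y ≡ x
  lift⁻¹-kept {inj₁ i} _ (inj₁ i′) e = cong inj₁ (inj₁-injective e)
  lift⁻¹-kept {inj₂ a} (x≢v₁ , x≢v₂) (inj₂ b) e with φ-inj b a (inj₂-injective e)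
  ... | inj₁ refl            = refl
  ... | inj₂ (_ , inj₁ refl) = contradiction refl x≢v₁
  ... | inj₂ (_ , inj₂ refl) = contradiction refl x≢v₂

  kept⇒lift≢M : ∀ {x} → Kept x → lift x ≢ M
  kept⇒lift≢M (x≢v₁ , x≢v₂) e with lift⁻¹-M _ e
  ... | inj₁ x≡v₁ = x≢v₁ x≡v₁
  ... | inj₂ x≡v₂ = x≢v₂ x≡v₂

  adj-kept : ∀ {x y} → Kept x → Kept y → adj GG (lift x) (lift y) ≡ adj GF x y
  adj-kept {x} {y} kx ky = ⇔→≡ (mk⇔ down up)
    where
    down : Adj GG (lift x) (lift y) → Adj GF x y
    down e with adj-to _ _ e
    ... | _ , x′ , y′ , x′↦x , y′↦y , x′~y′ =
      subst₂ (Adj GF) (lift⁻¹-kept kx x′ x′↦x) (lift⁻¹-kept ky y′ y′↦y) x′~y′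
    up : Adj GF x y → Adj GG (lift x) (lift y)
    up x~y = adj-fro x y x~y λ lx≡ly → loop (lift⁻¹-kept ky x lx≡ly) x~y
      where
      loop : ∀ {z} → z ≡ y → ¬ Adj GF z y
      loop refl z~z = contradiction (trans (sym (adj-irreflF _)) z~z) λ ()

  no-common-neighbour : ∀ {x} → Kept x → Adj GF x (inj₂ v₁) → Adj GF x (inj₂ v₂) → ⊥
  no-common-neighbour {x} (x≢v₁ , x≢v₂) x~v₁ x~v₂ =
    acyclic (x , triangle , s≤s (s≤s (s≤s z≤n)) , triangle-Unique)
    where
    triangle : Walk GF x x
    triangle = step x~v₁ (step adj₁₂ (step (trans (adj-symF _ _) x~v₂) stop))
    triangle-Unique : Unique (tailVerts GF triangle)
    triangle-Unique =
      ((v₁≢v₂ ∘ inj₂-injective) ∷ (x≢v₁ ∘ sym) ∷ []) ∷ ((x≢v₂ ∘ sym) ∷ []) ∷ [] ∷ []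

  adj-merged : ∀ {x} → Kept x → boolToℕ (adj GG (lift x) M) ≡ [ x ~ inj₂ v₁ ] ℕ.+ [ x ~ inj₂ v₂ ]
  adj-merged {x} kx with adj GF x (inj₂ v₁) in x~v₁ | adj GF x (inj₂ v₂) in x~v₂
  ... | true  | true  = contradiction (no-common-neighbour kx x~v₁ x~v₂) λ ()
  ... | true  | false = cong boolToℕ (adj-fro x (inj₂ v₁) x~v₁ (kept⇒lift≢M kx))
  ... | false | true  = cong boolToℕ (subst (Adj GG (lift x)) v₂↦M
                          (adj-fro x (inj₂ v₂) x~v₂ λ e → kept⇒lift≢M kx (trans e v₂↦M)))
    where
    v₂↦M : lift (inj₂ v₂) ≡ M
    v₂↦M = lift-merged (inj₂ refl)
  ... | false | false = cong boolToℕ (¬-not not-adjacent)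
    where
    not-adjacent : ¬ Adj GG (lift x) M
    not-adjacent e with adj-to _ _ e
    ... | _ , x′ , y′ , x′↦x , y′↦M , x′~y′ with lift⁻¹-kept kx x′ x′↦x | lift⁻¹-M y′ y′↦M
    ...   | refl | inj₁ refl = contradiction (trans (sym x~v₁) x′~y′) λ ()
    ...   | refl | inj₂ refl = contradiction (trans (sym x~v₂) x′~y′) λ ()

  adj-merged′ : ∀ {x} → Kept x → boolToℕ (adj GG M (lift x)) ≡ [ inj₂ v₁ ~ x ] ℕ.+ [ inj₂ v₂ ~ x ]
  adj-merged′ {x} kx rewrite adj-symG M (lift x) | adj-symF (inj₂ v₁) x | adj-symF (inj₂ v₂) x = adj-merged kx

  deg-kept : ∀ {x} → Kept x → deg GG (lift x) ≡ deg GF x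
  deg-kept {x} kx = cong₂ ℕ._+_
    (ℕΣ.Σᶠ-cong n (λ i → cong boolToℕ (adj-kept kx (kept-inj₁ i))))
    (sym (ℕΣ.Σᶠ-collapse φ-collapses (λ a → [ x ~ inj₂ a ]) (λ c → boolToℕ (adj GG (lift x) (inj₂ c)))
            (λ a a≢v₁ a≢v₂ → cong boolToℕ (adj-kept kx (kept-inj₂ a≢v₁ a≢v₂))) (adj-merged kx)))

  boundaryDeg-merged : boundaryDeg GF (inj₂ v₁) ℕ.+ boundaryDeg GF (inj₂ v₂) ≡ boundaryDeg GG M
  boundaryDeg-merged =
    trans (sym (ℕΣ.Σᶠ-distrib n _ _)) (ℕΣ.Σᶠ-cong n (λ i → sym (adj-merged′ (kept-inj₁ i))))

  internalDeg-merged : internalDeg GF (inj₂ v₁) ℕ.+ internalDeg GF (inj₂ v₂) ≡ internalDeg GG M ℕ.+ 2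
  internalDeg-merged = begin
    internalDeg GF (inj₂ v₁) ℕ.+ internalDeg GF (inj₂ v₂) ≡⟨ ℕΣ.Σᶠ-distrib (k GF) _ _ ⟨
    sumFin (k GF) [v₁v₂~_]
      ≡⟨ ℕΣ.Σᶠ-collapse φ-collapses _ _ kept-count merged-count ⟩
    sumFin (k GG) [M~_]+2δ                                ≡⟨ ℕΣ.Σᶠ-distrib (k GG) _ _ ⟩
    internalDeg GG M ℕ.+ sumFin (k GG) (λ c → [ does (c Fin.≟ φ v₁) ]· 2)
      ≡⟨ cong (internalDeg GG M ℕ.+_) (ℕΣ.Σᶠ-unique (k GG) (Fin._≟ φ v₁) (λ _ → 2) (λ _ → id) refl) ⟩
    internalDeg GG M ℕ.+ 2                                ∎
    where
    open ℕΣ using ([_]·_; []·-no)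
    [M~_] : Vtx n (k GG) → ℕ
    [M~ y ] = boolToℕ (adj GG M y)

    [v₁v₂~_] : Fin (k GF) → ℕ
    [v₁v₂~ a ] = [ inj₂ v₁ ~ inj₂ a ] ℕ.+ [ inj₂ v₂ ~ inj₂ a ]

    -- The edge v₁v₂ is counted twice on the left and has no counterpart in G.
    [M~_]+2δ : Fin (k GG) → ℕ
    [M~ c ]+2δ = [M~ inj₂ c ] ℕ.+ [ does (c Fin.≟ φ v₁) ]· 2

    kept-count : ∀ a → a ≢ v₁ → a ≢ v₂ → [M~ φ a ]+2δ ≡ [v₁v₂~ a ]
    kept-count a a≢v₁ a≢v₂ = begin
      [M~ inj₂ (φ a) ] ℕ.+ [ does (φ a Fin.≟ φ v₁) ]· 2
        ≡⟨ cong ([M~ inj₂ (φ a) ] ℕ.+_) ([]·-no (φ a Fin.≟ φ v₁) 2 φa≢φv₁) ⟩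
      [M~ inj₂ (φ a) ] ℕ.+ 0                            ≡⟨ ℕP.+-identityʳ _ ⟩
      [M~ inj₂ (φ a) ]                                  ≡⟨ adj-merged′ (kept-inj₂ a≢v₁ a≢v₂) ⟩
      [v₁v₂~ a ]                                        ∎
      where
      φa≢φv₁ : φ a ≢ φ v₁
      φa≢φv₁ = kept⇒lift≢M (kept-inj₂ a≢v₁ a≢v₂) ∘ cong inj₂

    merged-count : [M~ φ v₁ ]+2δ ≡ [v₁v₂~ v₁ ] ℕ.+ [v₁v₂~ v₂ ]
    merged-count
      rewrite adj-irreflG M | dec-true (φ v₁ Fin.≟ φ v₁) refl
            | adj-irreflF (inj₂ v₁) | adj-irreflF (inj₂ v₂)
            | adj₁₂ | trans (adj-symF (inj₂ v₂) (inj₂ v₁)) adj₁₂ = refl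

  deg-merged : deg GG M ℕ.+ 2 ≡ deg GF (inj₂ v₁) ℕ.+ deg GF (inj₂ v₂)
  deg-merged = begin
    (bdryM ℕ.+ intM) ℕ.+ 2                        ≡⟨ ℕP.+-assoc bdryM intM 2 ⟩
    bdryM ℕ.+ (intM ℕ.+ 2)                        ≡⟨ cong₂ ℕ._+_ boundaryDeg-merged internalDeg-merged ⟨
    (bdry₁ ℕ.+ bdry₂) ℕ.+ (int₁ ℕ.+ int₂)         ≡⟨ interchange bdry₁ bdry₂ int₁ int₂ ⟩
    (bdry₁ ℕ.+ int₁) ℕ.+ (bdry₂ ℕ.+ int₂)         ∎
    where
    open CommSemigroupProps ℕP.+-commutativeSemigroup using (interchange)
    bdryM intM bdry₁ bdry₂ int₁ int₂ : ℕ
    bdryM = boundaryDeg GG M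
    intM  = internalDeg GG M
    bdry₁ = boundaryDeg GF (inj₂ v₁)
    bdry₂ = boundaryDeg GF (inj₂ v₂)
    int₁  = internalDeg GF (inj₂ v₁)
    int₂  = internalDeg GF (inj₂ v₂)

  walk-lift : ∀ {x y} → Walk GF x y → Walk GG (lift x) (lift y)
  walk-lift stop = stop
  walk-lift (step {u} {v} u~v w) with lift u ≟ᵛ lift v
  ... | yes lu≡lv = subst (λ z → Walk GG z _) (sym lu≡lv) (walk-lift w)
  ... | no  lu≢lv = step (adj-fro u v u~v lu≢lv) (walk-lift w)

  fibre-walk : ∀ x y → lift x ≡ lift y → Walk GF x y
  fibre-walk x y lx≡ly with kept-or-merged x
  ... | inj₁ kx with lift⁻¹-kept kx y (sym lx≡ly)
  ...   | refl = stop
  fibre-walk x y lx≡ly | inj₂ mx = merged-walk mx (lift⁻¹-M y (trans (sym lx≡ly) (lift-merged mx)))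
    where
    merged-walk : ∀ {x y} → Merged x → Merged y → Walk GF x y
    merged-walk (inj₁ refl) (inj₁ refl) = stop
    merged-walk (inj₁ refl) (inj₂ refl) = step adj₁₂ stop
    merged-walk (inj₂ refl) (inj₁ refl) = step (trans (adj-symF _ _) adj₁₂) stop
    merged-walk (inj₂ refl) (inj₂ refl) = stop

  walk-unlift : ∀ {X Y} → Walk GG X Y → ∀ x y → lift x ≡ X → lift y ≡ Y → Walk GF x y
  walk-unlift stop       x y lx ly = fibre-walk x y (trans lx (sym ly))
  walk-unlift (step e w) x y lx ly with adj-to _ _ e
  ... | _ , x′ , y′ , lx′ , ly′ , x′~y′ =
    fibre-walk x x′ (trans lx (sym lx′)) ++ʷ step x′~y′ (walk-unlift w y′ y ly′ ly)

  conn-lift : ∀ x y → conn GF x y ≡ conn GG (lift x) (lift y)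
  conn-lift x y = conn-≡ walk-lift (λ w → walk-unlift w x y refl refl)

  mv-kept : ∀ {a} → a ≢ v₁ → a ≢ v₂ → mv GG (φ a) ≡ mv GF a
  mv-kept {a} a≢v₁ a≢v₂ = mv-cong GG GF (h-keep a a≢v₁ a≢v₂) (deg-kept (kept-inj₂ a≢v₁ a≢v₂))

  mv-merged : (mv GF v₁ ≡ deg GF (inj₂ v₁) ∸ 1) × (mv GF v₂ ≡ deg GF (inj₂ v₂) ∸ 1)
            × (mv GG (φ v₁) ≡ deg GG M ∸ 1)
  mv-merged with colour
  ... | inj₁ (w₁ , w₂ , w) =
    mv-nonGeneric GF v₁ (inj₁ w₁) , mv-nonGeneric GF v₂ (inj₁ w₂) , mv-nonGeneric GG (φ v₁) (inj₁ w)
  ... | inj₂ (b₁ , b₂ , b) =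
    mv-nonGeneric GF v₁ (inj₂ b₁) , mv-nonGeneric GF v₂ (inj₂ b₂) , mv-nonGeneric GG (φ v₁) (inj₂ b)

  1≤deg-M : 1 ≤ deg GG M
  1≤deg-M with to-bdryG (φ v₁)
  ... | _ , step M~v _ = adj⇒1≤deg GG M _ M~v

  weightTerm-merged : ∀ i → weightTerm GG i (φ v₁) ≡ weightTerm GF i v₁ ℤ.+ weightTerm GF i v₂
  weightTerm-merged i
    rewrite conn-lift (inj₁ i) (inj₂ v₁) | conn-lift (inj₁ i) (inj₂ v₂) | sym φ-merge
    with conn GG (inj₁ i) M
  ... | false = refl
  ... | true rewrite proj₁ mv-merged | proj₁ (proj₂ mv-merged) | proj₂ (proj₂ mv-merged) =
    pred∸-merge (deg GF (inj₂ v₁)) (deg GF (inj₂ v₂)) (deg GG M)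
      (adj⇒1≤deg GF _ _ adj₁₂) (adj⇒1≤deg GF _ _ (trans (adj-symF _ _) adj₁₂)) 1≤deg-M deg-merged

  componentWeight-lift : ∀ i → componentWeight GF i ≡ componentWeight GG i
  componentWeight-lift i = ℤΣ.Σᶠ-collapse φ-collapses (weightTerm GF i) (weightTerm GG i)
    (λ a a≢v₁ a≢v₂ → weightTerm-cong GG GF (sym (conn-lift (inj₁ i) (inj₂ a))) (mv-kept a≢v₁ a≢v₂))
    (weightTerm-merged i)

dimF-contract : ∀ {n} (F G : GForest n) → Contraction (graph F) (graph G) → dimF F ≡ dimF G
dimF-contract F G C = dimF-≡ F G (λ i i′ → conn-lift F G C (inj₁ i) (inj₁ i′)) (componentWeight-lift F G C)

dimF-move : ∀ {n} {F G : GForest n} → Move F G → dimF F ≡ dimF G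
dimF-move {F = F} {G} (contract C) = dimF-contract F G C
dimF-move {F = F} {G} (expand C)   = sym (dimF-contract G F C)
dimF-move {F = F} {G} (relabel I)  = dimF-relabel F G I

lemma3p11 : ∀ {n} (F F′ : GForest n) → RefEquiv F F′ → dimF F ≡ dimF F′
lemma3p11 F .F ε                       = refl
lemma3p11 F F′ (_◅_ {G = G} move rest) = trans (dimF-move move) (lemma3p11 G F′ rest)
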